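{- Consider the pebble game on $D$. At the end of time step $i$, a vertex not in $T$ has a number of pebbles equal to its outdegree if and only if it is minimal for $\preceq$ among the vertices in $V_i$.
   Context: Let $D=(V,A)$ be a directed acyclic graph with no isolated vertex, whose vertices are sources $S$ (indegree $0$, outdegree $1$), sinks $T$ (indegree $1$, outdegree $0$), and other vertices whose indegree equals their outdegree. Write $u\preceq v$ if there is a $u$-$v$ path in $D$ (a partial order). Pebble game: initially there is one pebble on each vertex of $S$. At each time step, every vertex whose number of pebbles equals its outdegree sends its pebbles along its outgoing arcs, exactly one pebble per arc. The game stops when every vertex has a number of pebbles different from its outdegree. Let $A_i$ be the set of arcs along which pebbles move at time step $i$, and $V_i$ the set of vertices occupied by pebbles at the end of time step $i$, with $V_0:=S$. -}

module Defs where

open import Data.Nat using (ℕ; zero; suc; _+_; _<_; _≡ᵇ_)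
open import Data.Fin using (Fin; zero; suc) renaming (_≟_ to _≟ᶠ_)
open import Data.Bool using (Bool; true; false; if_then_else_; _∧_; not)
open import Data.Product using (_×_)
open import Data.Sum using (_⊎_)
open import Relation.Nullary using (¬_; does)
open import Relation.Binary.PropositionalEquality using (_≡_)

count : ∀ {m} → (Fin m → Bool) → ℕ
count {zero}  f = 0
count {suc m} f = (if f zero then 1 else 0) + count (λ k → f (suc k))

record Digraph : Set where
  field
    n    : ℕ
    m    : ℕ
    tail : Fin m → Fin n
    head : Fin m → Fin n

module _ (D : Digraph) where
  open Digraph D

  Vertex : Set
  Vertex = Fin n

  outdeg : Vertex → ℕ
  outdeg v = count (λ a → does (tail a ≟ᶠ v))

  indeg : Vertex → ℕ
  indeg v = count (λ a → does (head a ≟ᶠ v))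

  data _⪯_ : Vertex → Vertex → Set where
    ⪯-refl : ∀ {v} → v ⪯ v
    ⪯-step : ∀ {v} (a : Fin m) → head a ⪯ v → tail a ⪯ v

  Acyclic : Set
  Acyclic = ∀ (a : Fin m) → ¬ (head a ⪯ tail a)

  -- every vertex is a source (indeg 0, outdeg 1), a sink (indeg 1, outdeg 0),
  -- or an other vertex with indeg = outdeg (> 0, as there is no isolated vertex)
  WellFormed : Set
  WellFormed = ∀ (v : Vertex) →
      (indeg v ≡ 0 × outdeg v ≡ 1)
    ⊎ (indeg v ≡ 1 × outdeg v ≡ 0)
    ⊎ (indeg v ≡ outdeg v × 0 < outdeg v)

  IsSource : Vertex → Set
  IsSource v = indeg v ≡ 0

  IsSink : Vertex → Set
  IsSink v = outdeg v ≡ 0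

  Config : Set
  Config = Vertex → ℕ

  initial : Config
  initial v = if indeg v ≡ᵇ 0 then 1 else 0

  fires : Config → Vertex → Bool
  fires p v = (p v ≡ᵇ outdeg v) ∧ not (outdeg v ≡ᵇ 0)

  step : Config → Config
  step p v = (if fires p v then 0 else p v)
           + count (λ a → fires p (tail a) ∧ does (head a ≟ᶠ v))

  -- configuration at the end of time step i (constant once the game stopped)
  pebbles : ℕ → Config
  pebbles zero    = initial
  pebbles (suc i) = step (pebbles i)

  Occupied : ℕ → Vertex → Set
  Occupied i v = 0 < pebbles i v

  Minimal : (Vertex → Set) → Vertex → Set
  Minimal X v = X v × (∀ u → X u → u ⪯ v → u ≡ v)

-- A vertex fires at most once.  By induction on time, a vertex that has fired is empty and all
-- its in-neighbours have fired too, so it never receives again; an unfired vertex holds its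
-- initial pebble plus one pebble per in-arc whose tail has fired.  As a source has outdegree 1
-- and every other non-sink has indegree = outdegree, an unfired non-sink is ready exactly when
-- all its in-neighbours have fired.  For an occupied vertex this is minimality: everything
-- strictly below a vertex whose in-neighbours all fired has fired (and is empty), while below an
-- unfired in-neighbour there is, by acyclicity, an occupied vertex.
module Submission where

open import Defs
open import Data.Nat using (ℕ; zero; suc; _+_; _≤_; _<_; _≤′_; ≤′-refl; ≤′-step; z≤n; s≤s; _≡ᵇ_)
open import Data.Nat.Properties
  using (≡ᵇ⇒≡; ≤-refl; +-mono-≤; +-mono-≤-<; +-suc; +-identityʳ; +-assoc; +-cancelˡ-≡; <⇒≢; n<1+n; ≤⇒≤′;
         m+n≡0⇒m≡0; m+n≡0⇒n≡0; n≢0⇒n>0; _≟_)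
open import Data.Fin as Fin using (Fin; toℕ) renaming (_≟_ to _≟ᶠ_)
open import Data.Fin.Properties using (pigeonhole)
open import Data.Bool using (Bool; true; false; if_then_else_; _∧_; _∨_; not; T)
open import Data.Bool.Properties using (∧-zeroʳ; ∧-conicalˡ; ∧-conicalʳ; ∧-identityʳ; ∧-distribʳ-∨; T-≡; T-∧)
open import Data.Product using (∃; ∃₂; _×_; _,_; proj₁; proj₂)
open import Data.Sum using (_⊎_; inj₁; inj₂)
open import Data.Empty using (⊥; ⊥-elim)
open import Function.Bundles using (_⇔_; mk⇔; Equivalence)
open import Relation.Nullary using (¬_; does; yes; no)
open import Relation.Binary.PropositionalEquality using (_≡_; refl; sym; trans; cong; cong₂; subst)

open Equivalence using (to; from)

indicator-mono : ∀ {a b : Bool} → (a ≡ true → b ≡ true) →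
                 (if a then 1 else 0) ≤ (if b then 1 else 0)
indicator-mono {false} _   = z≤n
indicator-mono {true}  a⇒b rewrite a⇒b refl = ≤-refl

count-cong : ∀ {m} {f g : Fin m → Bool} → (∀ k → f k ≡ g k) → count f ≡ count g
count-cong {zero}  _   = refl
count-cong {suc m} f≗g rewrite f≗g Fin.zero = cong (_ +_) (count-cong (λ k → f≗g (Fin.suc k)))

count-none : ∀ {m} {f : Fin m → Bool} → (∀ k → f k ≡ false) → count f ≡ 0
count-none {zero}  _    = refl
count-none {suc m} none rewrite none Fin.zero = count-none (λ k → none (Fin.suc k))

count≡0⇒false : ∀ {m} {f : Fin m → Bool} → count f ≡ 0 → ∀ k → f k ≡ false
count≡0⇒false {suc m} {f} c k with f Fin.zero in f₀
count≡0⇒false {suc m} {f} () k          | true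
count≡0⇒false {suc m} {f} c Fin.zero    | false = f₀
count≡0⇒false {suc m} {f} c (Fin.suc k) | false = count≡0⇒false c k

count≢0⇒true : ∀ {m} {f : Fin m → Bool} → ¬ count f ≡ 0 → ∃ λ k → f k ≡ true
count≢0⇒true {zero}      c = ⊥-elim (c refl)
count≢0⇒true {suc m} {f} c with f Fin.zero in f₀
... | true  = Fin.zero , f₀
... | false = let k , fk = count≢0⇒true c in Fin.suc k , fk

count-mono : ∀ {m} {f g : Fin m → Bool} → (∀ k → f k ≡ true → g k ≡ true) → count f ≤ count g
count-mono {zero}  _   = z≤n
count-mono {suc m} f⇒g = +-mono-≤ (indicator-mono (f⇒g Fin.zero)) (count-mono (λ k → f⇒g (Fin.suc k)))

count-mono-< : ∀ {m} {f g : Fin m → Bool} → (∀ k → f k ≡ true → g k ≡ true) →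
               ∀ k → f k ≡ false → g k ≡ true → count f < count g
count-mono-< {suc m} f⇒g Fin.zero f₀ g₀ rewrite f₀ | g₀ = s≤s (count-mono (λ k → f⇒g (Fin.suc k)))
count-mono-< {suc m} f⇒g (Fin.suc k) fk gk =
  +-mono-≤-< (indicator-mono (f⇒g Fin.zero)) (count-mono-< (λ k → f⇒g (Fin.suc k)) k fk gk)

count-∨ : ∀ {m} {f g : Fin m → Bool} → (∀ k → f k ≡ true → g k ≡ false) →
          count (λ k → f k ∨ g k) ≡ count f + count g
count-∨ {zero} _ = refl
count-∨ {suc m} {f} {g} disjoint with f Fin.zero in f₀ | g Fin.zero in g₀
... | false | false = count-∨ (λ k → disjoint (Fin.suc k))
... | false | true  = trans (cong suc (count-∨ (λ k → disjoint (Fin.suc k)))) (sym (+-suc _ _))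
... | true  | false = cong suc (count-∨ (λ k → disjoint (Fin.suc k)))
... | true  | true  with () ← trans (sym g₀) (disjoint Fin.zero f₀)

module _ (D : Digraph) where
  open Digraph D

  ⪯-trans : ∀ {u v w} → _⪯_ D u v → _⪯_ D v w → _⪯_ D u w
  ⪯-trans ⪯-refl         v⪯w = v⪯w
  ⪯-trans (⪯-step a h⪯v) v⪯w = ⪯-step a (⪯-trans h⪯v v⪯w)

  in-arc⇒⪯ : ∀ a {v} → head a ≡ v → _⪯_ D (tail a) v
  in-arc⇒⪯ a refl = ⪯-step a ⪯-refl

  -- Following in-arcs backwards from w forever would revisit a vertex after n steps, closing a cycle.
  predecessor-closed⇒empty : Acyclic D → (Q : Vertex D → Set) →
    (∀ w → Q w → ∃ λ a → head a ≡ w × Q (tail a)) → ∀ w → ¬ Q w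
  predecessor-closed⇒empty acyclic Q closed w Qw =
    revisit⇒cycle (pigeonhole (n<1+n n) (λ k → point (toℕ k)))
    where
    walk : ℕ → ∃ Q
    walk zero    = w , Qw
    walk (suc k) = let a , _ , Qa = closed _ (proj₂ (walk k)) in tail a , Qa

    point : ℕ → Vertex D
    point k = proj₁ (walk k)

    arc : ℕ → Fin m
    arc k = proj₁ (closed _ (proj₂ (walk k)))

    head-arc : ∀ k → head (arc k) ≡ point k
    head-arc k = proj₁ (proj₂ (closed _ (proj₂ (walk k))))

    descends : ∀ {j k} → j ≤′ k → _⪯_ D (point k) (point j)
    descends ≤′-refl            = ⪯-refl
    descends (≤′-step {k} j≤′k) =
      ⪯-step (arc k) (subst (λ x → _⪯_ D x _) (sym (head-arc k)) (descends j≤′k))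

    revisit⇒cycle : (∃₂ λ i j → i Fin.< j × point (toℕ i) ≡ point (toℕ j)) → ⊥
    revisit⇒cycle (i , j , i<j , point-i≡point-j) =
      acyclic (arc (toℕ i))
        (subst (λ x → _⪯_ D x (tail (arc (toℕ i)))) (sym (trans (head-arc (toℕ i)) point-i≡point-j))
               (descends (≤⇒≤′ i<j)))

module PebbleGame (D : Digraph) (wf : WellFormed D) where
  open Digraph D

  enters : Vertex D → Fin m → Bool
  enters v a = does (head a ≟ᶠ v)

  enters⇒head≡ : ∀ {v} a → enters v a ≡ true → head a ≡ v
  enters⇒head≡ {v} a e with head a ≟ᶠ v
  ... | yes h = h

  head≡⇒enters : ∀ {v} a → head a ≡ v → enters v a ≡ true
  head≡⇒enters {v} a h with head a ≟ᶠ v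
  ... | yes _  = refl
  ... | no h≢v = ⊥-elim (h≢v h)

  empty⇒¬fires : ∀ (p : Config D) v → p v ≡ 0 → fires D p v ≡ false
  empty⇒¬fires p v pv≡0 with p v | outdeg D v
  empty⇒¬fires p v refl | .0 | zero  = refl
  empty⇒¬fires p v refl | .0 | suc _ = refl

  fires⇒ready : ∀ (p : Config D) v → fires D p v ≡ true → p v ≡ outdeg D v × ¬ IsSink D v
  fires⇒ready p v fires≡ =
    ≡ᵇ⇒≡ _ _ (proj₁ both) , λ sink → subst (λ d → T (not (d ≡ᵇ 0))) sink (proj₂ both)
    where both = to T-∧ (from T-≡ fires≡)

  source⇒initial≡1 : ∀ {v} → indeg D v ≡ 0 → initial D v ≡ 1
  source⇒initial≡1 in≡0 = cong (λ d → if d ≡ᵇ 0 then 1 else 0) in≡0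

  non-source⇒initial≡0 : ∀ {v} → 0 < indeg D v → initial D v ≡ 0
  non-source⇒initial≡0 {v} in>0 with indeg D v
  non-source⇒initial≡0 {v} () | zero
  non-source⇒initial≡0 {v} _  | suc _ = refl

  initial+indeg≡outdeg : ∀ v → ¬ IsSink D v → initial D v + indeg D v ≡ outdeg D v
  initial+indeg≡outdeg v non-sink with wf v
  ... | inj₁ (in≡0 , out≡1)          = trans (cong₂ _+_ (source⇒initial≡1 in≡0) in≡0) (sym out≡1)
  ... | inj₂ (inj₁ (_ , out≡0))      = ⊥-elim (non-sink out≡0)
  ... | inj₂ (inj₂ (in≡out , out>0)) =
    trans (cong (_+ indeg D v) (non-source⇒initial≡0 (subst (0 <_) (sym in≡out) out>0))) in≡out

  fired : ℕ → Vertex D → Bool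
  fired zero    v = false
  fired (suc i) v = fired i v ∨ fires D (pebbles D i) v

  received : ℕ → Vertex D → ℕ
  received i v = count (λ a → fired i (tail a) ∧ enters v a)

  arriving : ℕ → Vertex D → ℕ
  arriving i v = count (λ a → fires D (pebbles D i) (tail a) ∧ enters v a)

  Saturated : ℕ → Vertex D → Set
  Saturated i v = ∀ a → head a ≡ v → fired i (tail a) ≡ true

  fired-mono : ∀ i {v} → fired i v ≡ true → fired (suc i) v ≡ true
  fired-mono i fired≡ rewrite fired≡ = refl

  saturated-mono : ∀ i {v} → Saturated i v → Saturated (suc i) v
  saturated-mono i sat a h = fired-mono i (sat a h)

  received≡indeg⇔saturated : ∀ i v → (received i v ≡ indeg D v ⇔ Saturated i v)
  received≡indeg⇔saturated i v = mk⇔ all-fired all-counted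
    where
    received⊆enters : ∀ a → fired i (tail a) ∧ enters v a ≡ true → enters v a ≡ true
    received⊆enters a = ∧-conicalʳ _ _

    all-fired : received i v ≡ indeg D v → Saturated i v
    all-fired r≡in a h with fired i (tail a) in tail-fired
    ... | true  = refl
    ... | false = ⊥-elim (<⇒≢ (count-mono-< received⊆enters a
                               (cong (_∧ enters v a) tail-fired)
                               (head≡⇒enters a h)) r≡in)

    all-counted : Saturated i v → received i v ≡ indeg D v
    all-counted sat = count-cong counted
      where
      counted : ∀ a → fired i (tail a) ∧ enters v a ≡ enters v a
      counted a with head a ≟ᶠ v
      ... | yes h = cong (_∧ true) (sat a h)
      ... | no _  = ∧-zeroʳ _

  record Invariant (i : ℕ) : Set where
    field
      pebbles-formula : ∀ v → pebbles D i v ≡ (if fired i v then 0 else initial D v + received i v)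
      fired⇒saturated : ∀ {v} → fired i v ≡ true → Saturated i v

    fired⇒empty : ∀ {v} → fired i v ≡ true → pebbles D i v ≡ 0
    fired⇒empty {v} fired≡ =
      trans (pebbles-formula v) (cong (λ b → if b then 0 else initial D v + received i v) fired≡)

    unfired⇒pebbles≡ : ∀ {v} → fired i v ≡ false → pebbles D i v ≡ initial D v + received i v
    unfired⇒pebbles≡ {v} unfired =
      trans (pebbles-formula v) (cong (λ b → if b then 0 else initial D v + received i v) unfired)

    fired⇒¬fires : ∀ {v} → fired i v ≡ true → fires D (pebbles D i) v ≡ false
    fired⇒¬fires fired≡ = empty⇒¬fires (pebbles D i) _ (fired⇒empty fired≡)

    saturated⇒nothing-arrives : ∀ {v} → Saturated i v → arriving i v ≡ 0
    saturated⇒nothing-arrives {v} sat = count-none nothing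
      where
      nothing : ∀ a → fires D (pebbles D i) (tail a) ∧ enters v a ≡ false
      nothing a with head a ≟ᶠ v
      ... | yes h = cong (_∧ true) (fired⇒¬fires (sat a h))
      ... | no _  = ∧-zeroʳ _

    pebbles≡outdeg⇔saturated : ∀ {v} → ¬ IsSink D v → fired i v ≡ false →
                               (pebbles D i v ≡ outdeg D v ⇔ Saturated i v)
    pebbles≡outdeg⇔saturated {v} non-sink unfired =
      mk⇔ (λ p≡out → to (received≡indeg⇔saturated i v) (+-cancelˡ-≡ (initial D v) _ _
                        (trans (sym (unfired⇒pebbles≡ unfired)) (trans p≡out (sym capacity)))))
          (λ sat → trans (unfired⇒pebbles≡ unfired)
                     (trans (cong (initial D v +_) (from (received≡indeg⇔saturated i v) sat)) capacity))
      where capacity = initial+indeg≡outdeg v non-sink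

    fires⇒saturated : ∀ {v} → fired i v ≡ false → fires D (pebbles D i) v ≡ true → Saturated i v
    fires⇒saturated {v} unfired fires≡ =
      let ready , non-sink = fires⇒ready (pebbles D i) v fires≡
      in to (pebbles≡outdeg⇔saturated non-sink unfired) ready

  invariant : ∀ i → Invariant i
  invariant zero = record
    { pebbles-formula = λ v →
        sym (trans (cong (initial D v +_) (count-none {m} (λ _ → refl))) (+-identityʳ _))
    ; fired⇒saturated = λ ()
    }
  invariant (suc i) = record { pebbles-formula = formula ; fired⇒saturated = saturated }
    where
    open Invariant (invariant i)

    received-step : ∀ v → received (suc i) v ≡ received i v + arriving i v
    received-step v =
      trans (count-cong (λ a → ∧-distribʳ-∨ (enters v a) (fired i (tail a)) (fires D (pebbles D i) (tail a))))
            (count-∨ (λ a counted → cong (_∧ enters v a) (fired⇒¬fires (∧-conicalˡ _ _ counted))))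

    formula : ∀ v → pebbles D (suc i) v ≡ (if fired (suc i) v then 0 else initial D v + received (suc i) v)
    formula v with fired i v in fired≡ | fires D (pebbles D i) v in fires≡
    ... | true  | true  with () ← trans (sym fires≡) (fired⇒¬fires fired≡)
    ... | true  | false =
      cong₂ _+_ (fired⇒empty fired≡) (saturated⇒nothing-arrives (fired⇒saturated fired≡))
    ... | false | true  = saturated⇒nothing-arrives (fires⇒saturated fired≡ fires≡)
    ... | false | false =
      trans (cong (_+ arriving i v) (unfired⇒pebbles≡ fired≡))
            (trans (+-assoc (initial D v) _ _) (cong (initial D v +_) (sym (received-step v))))

    saturated : ∀ {v} → fired (suc i) v ≡ true → Saturated (suc i) v
    saturated {v} fired′ with fired i v in fired≡
    ... | true  = saturated-mono i (fired⇒saturated fired≡)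
    ... | false = saturated-mono i (fires⇒saturated fired≡ fired′)

  occupied⇒unfired : ∀ i {u} → Occupied D i u → fired i u ≡ false
  occupied⇒unfired i {u} occ with fired i u in fired≡
  ... | false = refl
  ... | true  = ⊥-elim (<⇒≢ occ (sym (Invariant.fired⇒empty (invariant i) fired≡)))

  saturated⇒below-fired : ∀ i {u w} → Saturated i w → _⪯_ D u w → u ≡ w ⊎ fired i u ≡ true
  saturated⇒below-fired i sat ⪯-refl = inj₁ refl
  saturated⇒below-fired i sat (⪯-step a head⪯w) with saturated⇒below-fired i sat head⪯w
  ... | inj₁ head≡w     = inj₂ (sat a head≡w)
  ... | inj₂ head-fired = inj₂ (Invariant.fired⇒saturated (invariant i) head-fired a refl)

  -- An unoccupied unfired vertex has an in-arc from an unfired vertex, so unfired vertices without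
  -- an occupied vertex below them would form a predecessor-closed set.
  unfired⇒occupied-below : Acyclic D → ∀ i {w} → fired i w ≡ false →
                           ¬ ¬ (∃ λ u → Occupied D i u × _⪯_ D u w)
  unfired⇒occupied-below acyclic i {w} unfired none =
    predecessor-closed⇒empty D acyclic Unreached closed w (unfired , none)
    where
    open Invariant (invariant i)

    Unreached : Vertex D → Set
    Unreached x = fired i x ≡ false × ¬ (∃ λ u → Occupied D i u × _⪯_ D u x)

    closed : ∀ x → Unreached x → ∃ λ a → head a ≡ x × Unreached (tail a)
    closed x (unfired , none) =
      a , head≡x , tail-unfired ,
      λ (u , occ , u⪯tail) → none (u , occ , ⪯-trans D u⪯tail (in-arc⇒⪯ D a head≡x))
      where
      empty : pebbles D i x ≡ 0
      empty with pebbles D i x ≟ 0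
      ... | yes p≡0 = p≡0
      ... | no  p≢0 = ⊥-elim (none (x , n≢0⇒n>0 p≢0 , ⪯-refl))

      nothing-yet : initial D x + received i x ≡ 0
      nothing-yet = trans (sym (unfired⇒pebbles≡ unfired)) empty

      non-source : ¬ indeg D x ≡ 0
      non-source in≡0 with () ← trans (sym (source⇒initial≡1 in≡0)) (m+n≡0⇒m≡0 _ nothing-yet)

      in-arc : ∃ λ a → enters x a ≡ true
      in-arc = count≢0⇒true non-source

      a : Fin m
      a = proj₁ in-arc

      head≡x : head a ≡ x
      head≡x = enters⇒head≡ a (proj₂ in-arc)

      tail-unfired : fired i (tail a) ≡ false
      tail-unfired = trans (sym (∧-identityʳ _))
        (subst (λ b → fired i (tail a) ∧ b ≡ false) (proj₂ in-arc)
               (count≡0⇒false (m+n≡0⇒n≡0 _ nothing-yet) a))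

  saturated⇒minimal : ∀ i {v} → Occupied D i v → Saturated i v → Minimal D (Occupied D i) v
  saturated⇒minimal i {v} occ sat = occ , below
    where
    below : ∀ u → Occupied D i u → _⪯_ D u v → u ≡ v
    below u occ-u u⪯v with saturated⇒below-fired i sat u⪯v
    ... | inj₁ u≡v     = u≡v
    ... | inj₂ u-fired with () ← trans (sym (occupied⇒unfired i occ-u)) u-fired

  minimal⇒saturated : Acyclic D → ∀ i {v} → Minimal D (Occupied D i) v → Saturated i v
  minimal⇒saturated acyclic i (occ , minimal) a head≡v with fired i (tail a) in tail-fired
  ... | true  = refl
  ... | false = ⊥-elim (unfired⇒occupied-below acyclic i tail-fired λ (u , occ-u , u⪯tail) →
    let u≡v = minimal u occ-u (⪯-trans D u⪯tail (in-arc⇒⪯ D a head≡v))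
    in acyclic a (subst (λ x → _⪯_ D x (tail a)) (trans u≡v (sym head≡v)) u⪯tail))

lemma3p4 : (D : Digraph) → Acyclic D → WellFormed D →
    ∀ (i : ℕ) (v : Vertex D) → ¬ IsSink D v →
    (pebbles D i v ≡ outdeg D v) ⇔ Minimal D (Occupied D i) v
lemma3p4 D acyclic wf i v non-sink = mk⇔
  (λ ready → let occ = subst (0 <_) (sym ready) (n≢0⇒n>0 non-sink)
             in saturated⇒minimal i occ (to (ready⇔saturated (occupied⇒unfired i occ)) ready))
  (λ minimal → from (ready⇔saturated (occupied⇒unfired i (proj₁ minimal)))
                    (minimal⇒saturated acyclic i minimal))
  where
  open PebbleGame D wf

  ready⇔saturated : fired i v ≡ false → (pebbles D i v ≡ outdeg D v ⇔ Saturated i v)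
  ready⇔saturated = Invariant.pebbles≡outdeg⇔saturated (invariant i) non-sink
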